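{- Let $G$ be a graph of order $n$ and let $k$ be an integer with $k\le \min\{\delta(G),\delta(\overline{G})\}$. Then $$\gamma_{\times (k-1),t}^{r}(G)+\gamma_{\times (k-1),t}^{r}(\overline{G})\le \gamma_{\times k,t}^{r}(G\overline{G})\le \gamma_{\times k,t}^{r}(G)+\gamma_{\times k,t}^{r}(\overline{G}),$$ where the lower bound is asserted for $k\ge 2$ and the upper bound for $k\ge 1$.
   Context: All graphs are finite and simple; $N(x)$ denotes the open neighborhood of $x$, $\delta$ the minimum degree, and $\overline{G}$ the complement of $G$. For an integer $k\ge 1$, a set $S\subseteq V(H)$ is a $k$-tuple total dominating set of $H$ if $|N(x)\cap S|\ge k$ for every $x\in V(H)$. It is a $k$-tuple total restrained dominating set (kTRDS) if moreover every vertex $x\in V(H)\setminus S$ is adjacent to at least $k$ vertices of $V(H)\setminus S$; $\gamma_{\times k,t}^{r}(H)$ is the minimum cardinality of a kTRDS of $H$ (for $k=1$ this is the total restrained domination number). The complementary prism $G\overline{G}$ is the graph formed from the disjoint union of $G$ and $\overline{G}$ by adding a perfect matching joining each vertex of $G$ to its copy in $\overline{G}$. -}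

module Defs where

open import Data.Nat using (ℕ; _+_; _≤_)
open import Data.Bool using (Bool; true; false; not; _∧_)
open import Data.Fin using (Fin; splitAt)
open import Data.Fin.Properties using (_≟_)
open import Data.Fin.Subset using (Subset; ∁; _∩_; ∣_∣)
open import Data.Vec using (tabulate; lookup)
open import Data.Sum using (inj₁; inj₂)
open import Data.Product using (_×_; ∃)
open import Relation.Binary.PropositionalEquality using (_≡_)
open import Relation.Nullary.Decidable using (⌊_⌋)

Adj : ℕ → Set
Adj n = Fin n → Fin n → Bool

record Graph (n : ℕ) : Set where
  field
    adj    : Adj n
    sym    : ∀ x y → adj x y ≡ adj y x
    irrefl : ∀ x → adj x x ≡ false
open Graph public

N : ∀ {n} → Adj n → Fin n → Subset n
N a x = tabulate (a x)

complAdj : ∀ {n} → Adj n → Adj n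
complAdj a x y = not (a x y) ∧ not ⌊ x ≟ y ⌋

complement : ∀ {n} → Graph n → Adj n
complement G = complAdj (adj G)

-- Complementary prism G Ḡ on Fin (n + n): the first n vertices are G,
-- the last n vertices are the copy of Ḡ, and vertex i of G is matched to
-- its copy i of Ḡ.
prism : ∀ {n} → Graph n → Adj (n + n)
prism {n} G x y with splitAt n x | splitAt n y
... | inj₁ i | inj₁ j = adj G i j
... | inj₂ i | inj₂ j = complAdj (adj G) i j
... | inj₁ i | inj₂ j = ⌊ i ≟ j ⌋
... | inj₂ i | inj₁ j = ⌊ i ≟ j ⌋

IsKTRDS : ∀ {n} → Adj n → ℕ → Subset n → Set
IsKTRDS {n} a k S =
  (∀ x → k ≤ ∣ N a x ∩ S ∣) ×
  (∀ x → lookup S x ≡ false → k ≤ ∣ N a x ∩ ∁ S ∣)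

IsGammaKTR : ∀ {n} → Adj n → ℕ → ℕ → Set
IsGammaKTR a k m =
  (∃ λ S → IsKTRDS a k S × ∣ S ∣ ≡ m) ×
  (∀ S → IsKTRDS a k S → m ≤ ∣ S ∣)

MinDegAtLeast : ∀ {n} → Adj n → ℕ → Set
MinDegAtLeast a k = ∀ x → k ≤ ∣ N a x ∣

module Submission where

-- A kTRDS of G Ḡ splits as S ++ T with S ⊆ V(G) and T ⊆ V(Ḡ). Every vertex of the
-- prism has exactly one neighbour across the perfect matching, so on each side the
-- matching contributes at most one to both counts required of a kTRDS: S and T are
-- (k−1)-tuple total restrained dominating sets of G and Ḡ, giving the lower bound.
-- Conversely the matching only adds neighbours, so the juxtaposition of kTRDSs of G
-- and Ḡ is a kTRDS of G Ḡ, giving the upper bound.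

open import Defs hiding (sym)
open import Data.Nat using (ℕ; zero; suc; _+_; _≤_; _∸_; z≤n; s≤s⁻¹)
open import Data.Nat.Properties using (≤-reflexive; ≤-trans; m≤m+n; m≤n+m; +-monoʳ-≤; +-comm; +-mono-≤)
open import Data.Product using (_×_; _,_)
open import Data.Bool using (false; not; _∧_)
open import Data.Fin using (Fin; zero; suc; _↑ˡ_; _↑ʳ_; splitAt; join)
open import Data.Fin.Properties using (_≟_; splitAt-↑ˡ; splitAt-↑ʳ; join-splitAt)
open import Data.Fin.Subset using (Subset; ∁; _∩_; ∣_∣; ⁅_⁆; ⊥; inside; outside)
open import Data.Fin.Subset.Properties using (∣⁅x⁆∣≡1; ∣p∩q∣≤∣p∣)
open import Data.Vec using ([]; _∷_; tabulate; lookup; _++_)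
import Data.Vec as Vec
open import Data.Vec.Properties using (tabulate-cong; zipWith-++; map-++; lookup-++ˡ; lookup-++ʳ)
open import Data.Sum using (inj₁; inj₂)
open import Relation.Binary.PropositionalEquality using (_≡_; refl; sym; trans; cong; cong₂; subst)
open import Relation.Nullary.Decidable using (⌊_⌋; yes; no)

m≤n+o∧o≤1⇒m∸1≤n : ∀ m n o → m ≤ n + o → o ≤ 1 → m ∸ 1 ≤ n
m≤n+o∧o≤1⇒m∸1≤n zero    n o _   _   = z≤n
m≤n+o∧o≤1⇒m∸1≤n (suc m) n o m≤ o≤1 =
  s≤s⁻¹ (≤-trans m≤ (≤-trans (+-monoʳ-≤ n o≤1) (≤-reflexive (+-comm n 1))))

↑-elim : ∀ {m n} (P : Fin (m + n) → Set) →
         (∀ i → P (i ↑ˡ n)) → (∀ j → P (m ↑ʳ j)) → ∀ x → P x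
↑-elim {m} {n} P left right x = subst P (join-splitAt m n x) (onSplit (splitAt m x))
  where
  onSplit : ∀ s → P (join m n s)
  onSplit (inj₁ i) = left i
  onSplit (inj₂ j) = right j

tabulate-++ : ∀ {A : Set} m n (f : Fin (m + n) → A) →
              tabulate f ≡ tabulate (λ i → f (i ↑ˡ n)) ++ tabulate (λ j → f (m ↑ʳ j))
tabulate-++ zero    n f = refl
tabulate-++ (suc m) n f = cong (f zero ∷_) (tabulate-++ m n (λ i → f (suc i)))

∣p++q∣≡∣p∣+∣q∣ : ∀ {m n} (p : Subset m) (q : Subset n) → ∣ p ++ q ∣ ≡ ∣ p ∣ + ∣ q ∣
∣p++q∣≡∣p∣+∣q∣ []            q = refl
∣p++q∣≡∣p∣+∣q∣ (inside ∷ p)  q = cong suc (∣p++q∣≡∣p∣+∣q∣ p q)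
∣p++q∣≡∣p∣+∣q∣ (outside ∷ p) q = ∣p++q∣≡∣p∣+∣q∣ p q

∣p++q∩r++s∣ : ∀ {m n} (p r : Subset m) (q s : Subset n) →
              ∣ (p ++ q) ∩ (r ++ s) ∣ ≡ ∣ p ∩ r ∣ + ∣ q ∩ s ∣
∣p++q∩r++s∣ p r q s = trans (cong ∣_∣ (zipWith-++ _∧_ p q r s)) (∣p++q∣≡∣p∣+∣q∣ (p ∩ r) (q ∩ s))

∁-++ : ∀ {m n} (p : Subset m) (q : Subset n) → ∁ (p ++ q) ≡ ∁ p ++ ∁ q
∁-++ = map-++ not

tabulate-≟≡⁅⁆ : ∀ {n} (i : Fin n) → tabulate (λ j → ⌊ i ≟ j ⌋) ≡ ⁅ i ⁆
tabulate-≟≡⁅⁆ {suc n} zero    = cong (inside ∷_) (allFalse n)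
  where
  allFalse : ∀ n → tabulate {n = n} (λ _ → false) ≡ ⊥
  allFalse zero    = refl
  allFalse (suc n) = cong (false ∷_) (allFalse n)
tabulate-≟≡⁅⁆ {suc n} (suc i) = cong (false ∷_) (trans (tabulate-cong ≟-suc) (tabulate-≟≡⁅⁆ i))
  where
  ≟-suc : ∀ j → ⌊ suc i ≟ suc j ⌋ ≡ ⌊ i ≟ j ⌋
  ≟-suc j with i ≟ j
  ... | yes _ = refl
  ... | no  _ = refl

∣⁅x⁆∩p∣≤1 : ∀ {n} (x : Fin n) (p : Subset n) → ∣ ⁅ x ⁆ ∩ p ∣ ≤ 1
∣⁅x⁆∩p∣≤1 x p = ≤-trans (∣p∩q∣≤∣p∣ ⁅ x ⁆ p) (≤-reflexive (∣⁅x⁆∣≡1 x))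

module _ {n} (G : Graph n) where

  N-prism-↑ˡ : ∀ i → N (prism G) (i ↑ˡ n) ≡ N (adj G) i ++ ⁅ i ⁆
  N-prism-↑ˡ i = trans (tabulate-++ n n _)
    (cong₂ _++_ (tabulate-cong inG) (trans (tabulate-cong matched) (tabulate-≟≡⁅⁆ i)))
    where
    inG : ∀ j → prism G (i ↑ˡ n) (j ↑ˡ n) ≡ adj G i j
    inG j rewrite splitAt-↑ˡ n i n | splitAt-↑ˡ n j n = refl
    matched : ∀ j → prism G (i ↑ˡ n) (n ↑ʳ j) ≡ ⌊ i ≟ j ⌋
    matched j rewrite splitAt-↑ˡ n i n | splitAt-↑ʳ n n j = refl

  N-prism-↑ʳ : ∀ i → N (prism G) (n ↑ʳ i) ≡ ⁅ i ⁆ ++ N (complement G) i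
  N-prism-↑ʳ i = trans (tabulate-++ n n _)
    (cong₂ _++_ (trans (tabulate-cong matched) (tabulate-≟≡⁅⁆ i)) (tabulate-cong inḠ))
    where
    matched : ∀ j → prism G (n ↑ʳ i) (j ↑ˡ n) ≡ ⌊ i ≟ j ⌋
    matched j rewrite splitAt-↑ʳ n n i | splitAt-↑ˡ n j n = refl
    inḠ : ∀ j → prism G (n ↑ʳ i) (n ↑ʳ j) ≡ complement G i j
    inḠ j rewrite splitAt-↑ʳ n n i | splitAt-↑ʳ n n j = refl

  ∣N-prism-↑ˡ∩∣ : ∀ i (S T : Subset n) →
    ∣ N (prism G) (i ↑ˡ n) ∩ (S ++ T) ∣ ≡ ∣ N (adj G) i ∩ S ∣ + ∣ ⁅ i ⁆ ∩ T ∣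
  ∣N-prism-↑ˡ∩∣ i S T rewrite N-prism-↑ˡ i = ∣p++q∩r++s∣ (N (adj G) i) S ⁅ i ⁆ T

  ∣N-prism-↑ʳ∩∣ : ∀ i (S T : Subset n) →
    ∣ N (prism G) (n ↑ʳ i) ∩ (S ++ T) ∣ ≡ ∣ N (complement G) i ∩ T ∣ + ∣ ⁅ i ⁆ ∩ S ∣
  ∣N-prism-↑ʳ∩∣ i S T rewrite N-prism-↑ʳ i =
    trans (∣p++q∩r++s∣ ⁅ i ⁆ S (N (complement G) i) T) (+-comm ∣ ⁅ i ⁆ ∩ S ∣ _)

  ∣N-prism∩∁∣ : ∀ x (S T : Subset n) →
    ∣ N (prism G) x ∩ ∁ (S ++ T) ∣ ≡ ∣ N (prism G) x ∩ (∁ S ++ ∁ T) ∣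
  ∣N-prism∩∁∣ x S T = cong (λ U → ∣ N (prism G) x ∩ U ∣) (∁-++ S T)

  restrict-KTRDS : ∀ k (S T : Subset n) → IsKTRDS (prism G) k (S ++ T) →
    IsKTRDS (adj G) (k ∸ 1) S × IsKTRDS (complement G) (k ∸ 1) T
  restrict-KTRDS k S T (dom , res) =
    ( (λ i → inG i S T (dom (i ↑ˡ n)))
    , (λ i i∉S → inG i (∁ S) (∁ T)
        (subst (k ≤_) (∣N-prism∩∁∣ _ S T) (res (i ↑ˡ n) (trans (lookup-++ˡ S T i) i∉S)))) )
    , ( (λ i → inḠ i S T (dom (n ↑ʳ i)))
      , (λ i i∉T → inḠ i (∁ S) (∁ T)
          (subst (k ≤_) (∣N-prism∩∁∣ _ S T) (res (n ↑ʳ i) (trans (lookup-++ʳ S T i) i∉T)))) )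
    where
    inG : ∀ i X Y → k ≤ ∣ N (prism G) (i ↑ˡ n) ∩ (X ++ Y) ∣ → k ∸ 1 ≤ ∣ N (adj G) i ∩ X ∣
    inG i X Y k≤ = m≤n+o∧o≤1⇒m∸1≤n k _ _ (subst (k ≤_) (∣N-prism-↑ˡ∩∣ i X Y) k≤) (∣⁅x⁆∩p∣≤1 i Y)
    inḠ : ∀ i X Y → k ≤ ∣ N (prism G) (n ↑ʳ i) ∩ (X ++ Y) ∣ → k ∸ 1 ≤ ∣ N (complement G) i ∩ Y ∣
    inḠ i X Y k≤ = m≤n+o∧o≤1⇒m∸1≤n k _ _ (subst (k ≤_) (∣N-prism-↑ʳ∩∣ i X Y) k≤) (∣⁅x⁆∩p∣≤1 i X)

  ++-KTRDS : ∀ k (S T : Subset n) → IsKTRDS (adj G) k S → IsKTRDS (complement G) k T →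
    IsKTRDS (prism G) k (S ++ T)
  ++-KTRDS k S T (domS , resS) (domT , resT) =
    ↑-elim (λ x → k ≤ ∣ N (prism G) x ∩ (S ++ T) ∣)
      (λ i → inG i S T (domS i))
      (λ i → inḠ i S T (domT i))
    , ↑-elim (λ x → lookup (S ++ T) x ≡ false → k ≤ ∣ N (prism G) x ∩ ∁ (S ++ T) ∣)
      (λ i i∉ → subst (k ≤_) (sym (∣N-prism∩∁∣ _ S T))
                  (inG i (∁ S) (∁ T) (resS i (trans (sym (lookup-++ˡ S T i)) i∉))))
      (λ i i∉ → subst (k ≤_) (sym (∣N-prism∩∁∣ _ S T))
                  (inḠ i (∁ S) (∁ T) (resT i (trans (sym (lookup-++ʳ S T i)) i∉))))
    where
    inG : ∀ i X Y → k ≤ ∣ N (adj G) i ∩ X ∣ → k ≤ ∣ N (prism G) (i ↑ˡ n) ∩ (X ++ Y) ∣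
    inG i X Y k≤ = subst (k ≤_) (sym (∣N-prism-↑ˡ∩∣ i X Y)) (≤-trans k≤ (m≤m+n _ _))
    inḠ : ∀ i X Y → k ≤ ∣ N (complement G) i ∩ Y ∣ → k ≤ ∣ N (prism G) (n ↑ʳ i) ∩ (X ++ Y) ∣
    inḠ i X Y k≤ = subst (k ≤_) (sym (∣N-prism-↑ʳ∩∣ i X Y)) (≤-trans k≤ (m≤m+n _ _))

theorem5p4 : ∀ {n} (G : Graph n) (k : ℕ) →
    MinDegAtLeast (adj G) k → MinDegAtLeast (complement G) k →
    ∀ (a b a' b' c : ℕ) →
    IsGammaKTR (adj G) k a → IsGammaKTR (complement G) k b →
    IsGammaKTR (adj G) (k ∸ 1) a' → IsGammaKTR (complement G) (k ∸ 1) b' →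
    IsGammaKTR (prism G) k c →
    (2 ≤ k → a' + b' ≤ c) × (1 ≤ k → c ≤ a + b)
theorem5p4 {n} G k _ _ a b a' b' c
  ((SG , SG-KTRDS , ∣SG∣≡a) , _) ((SḠ , SḠ-KTRDS , ∣SḠ∣≡b) , _)
  (_ , a'-minimal) (_ , b'-minimal) ((P , P-KTRDS , ∣P∣≡c) , c-minimal) =
  (λ _ → lower) , (λ _ → upper)
  where
  lower : a' + b' ≤ c
  lower with Vec.splitAt n P
  ... | S , T , refl =
    let (S-KTRDS , T-KTRDS) = restrict-KTRDS G k S T P-KTRDS in
    subst (a' + b' ≤_) (trans (sym (∣p++q∣≡∣p∣+∣q∣ S T)) ∣P∣≡c)
      (+-mono-≤ (a'-minimal S S-KTRDS) (b'-minimal T T-KTRDS))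
  upper : c ≤ a + b
  upper = subst (c ≤_) (trans (∣p++q∣≡∣p∣+∣q∣ SG SḠ) (cong₂ _+_ ∣SG∣≡a ∣SḠ∣≡b))
            (c-minimal (SG ++ SḠ) (++-KTRDS G k SG SḠ SG-KTRDS SḠ-KTRDS))
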